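{- Let $t$ be an $\mathrm{SL}_2$-tiling and let $i<j$ and $p<q$ be integers. Then $t_{ip}t_{jq}-t_{iq}t_{jp}=c_{ij}d_{pq}$. In particular, this determinant is a positive integer.
   Context: An $\mathrm{SL}_2$-tiling is a map $t:\mathbb{Z}\times\mathbb{Z}\to\{1,2,3,\dots\}$, $(i,j)\mapsto t_{ij}$, with $t_{ij}t_{i+1,j+1}-t_{i,j+1}t_{i+1,j}=1$ for all $i,j$. For integers $i<j$ define $c_{ij}=t_{ia}t_{j,a+1}-t_{i,a+1}t_{ja}$ and $d_{ij}=t_{ai}t_{a+1,j}-t_{aj}t_{a+1,i}$, where $a$ is any integer; these values do not depend on the choice of $a$. -}

module Defs where

open import Data.Integer using (ℤ; _+_; _-_; _*_; _>_; +_; 0ℤ; 1ℤ)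
open import Relation.Binary.PropositionalEquality using (_≡_)

record SL₂Tiling : Set where
  field
    t        : ℤ → ℤ → ℤ
    positive : ∀ i j → t i j > 0ℤ
    unimod   : ∀ i j → t i j * t (i + 1ℤ) (j + 1ℤ) - t i (j + 1ℤ) * t (i + 1ℤ) j ≡ 1ℤ

open SL₂Tiling public

-- c_{ij} = t_{ia} t_{j,a+1} - t_{i,a+1} t_{ja}, computed with a = 0
-- (the paper notes the value is independent of a).
c : SL₂Tiling → ℤ → ℤ → ℤ
c T i j = t T i 0ℤ * t T j 1ℤ - t T i 1ℤ * t T j 0ℤ

-- d_{ij} = t_{ai} t_{a+1,j} - t_{aj} t_{a+1,i}, computed with a = 0.
d : SL₂Tiling → ℤ → ℤ → ℤ
d T i j = t T 0ℤ i * t T 1ℤ j - t T 0ℤ j * t T 1ℤ i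

module Submission where

-- Write det u v p q = u p * v q - u q * v p for the 2×2 minor
-- of two rows u, v on the columns p, q; the theorem concerns the minor of
-- rows i, j of the tiling, and c i j, d p q are themselves such minors.
--
-- 1. Three consecutive rows a, b, g of a positive array whose adjacent
--    minors are 1 satisfy a + g = e · b for a constant e (a Plücker
--    relation gives e p · b = a + g near p, and cancelling b shows that
--    e p does not depend on p).
-- 2. Consequently, by induction over ℤ in both directions, every row of a
--    tiling is an integer combination of rows 0 and 1.
-- 3. For rows in the span of x, y every minor is a fixed multiple of the
--    corresponding minor of x, y (Cauchy–Binet); since d 0 1 = 1 this
--    gives t_ip t_jq - t_iq t_jp = c_ij · d_pq.
-- 4. Two rows with adjacent minors 1 and positive second row have all
--    minors det u v p q with p < q positive (induction on q - p, again by
--    Plücker).  Applied to rows 0, 1 and to columns 0, 1 this makes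
--    c_ij and d_pq positive, hence so is their product.

open import Defs
open import Data.Integer using (ℤ; _-_; _*_; _<_; _>_; 0ℤ)
open import Data.Product using (_×_)
open import Relation.Binary.PropositionalEquality using (_≡_)

open import Data.Nat as ℕ using (zero; suc)
open import Data.Integer using (_+_; +_; -[1+_]; 1ℤ; +<+; >-nonZero; nonNegative)
  renaming (suc to sucℤ)
import Data.Nat.Properties as ℕP
open import Data.Integer.Properties
  using ( *-cancelʳ-≡; *-cancelˡ-<-nonNeg; *-zeroʳ; *-comm; *-identityˡ; *-identityʳ
        ; +-comm; +-assoc; +-mono-<; <⇒≤; i≤j⇒0≤j-i; i<j⇒suc[i]≤j)
open import Data.Integer.Solver using (module +-*-Solver)
open import Data.Product using (_,_; ∃; ∃₂; proj₁; proj₂)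
open import Relation.Binary.PropositionalEquality
  using (refl; sym; trans; cong; cong₂; subst; module ≡-Reasoning)
open +-*-Solver using (solve; _:+_; _:-_; _:*_; _:=_; con)
open ≡-Reasoning

*-pos : ∀ {a b} → a > 0ℤ → b > 0ℤ → a * b > 0ℤ
*-pos (+<+ (ℕ.s≤s _)) (+<+ (ℕ.s≤s _)) = +<+ (ℕ.s≤s ℕ.z≤n)

+-pos : ∀ {a b} → a > 0ℤ → b > 0ℤ → a + b > 0ℤ
+-pos = +-mono-<

*-cancelˡ-pos : ∀ {a b} → a > 0ℤ → a * b > 0ℤ → b > 0ℤ
*-cancelˡ-pos {a} {b} a>0 ab>0 =
  *-cancelˡ-<-nonNeg a {{nonNegative (<⇒≤ a>0)}} (subst (_< a * b) (sym (*-zeroʳ a)) ab>0)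

*-cancelʳ-pos-≡ : ∀ {x y b} → b > 0ℤ → x * b ≡ y * b → x ≡ y
*-cancelʳ-pos-≡ {x} {y} {b} b>0 = *-cancelʳ-≡ x y b {{>-nonZero b>0}}

ℤ-induction : (P : ℤ → Set) → P 0ℤ →
  (∀ i → P i → P (i + 1ℤ)) → (∀ i → P (i + 1ℤ) → P i) → ∀ i → P i
ℤ-induction P base up down (+ zero) = base
ℤ-induction P base up down (+ suc n) =
  subst P (cong +_ (ℕP.+-comm n 1)) (up (+ n) (ℤ-induction P base up down (+ n)))
ℤ-induction P base up down -[1+ zero ] = down -[1+ zero ] base
ℤ-induction P base up down -[1+ suc n ] =
  down -[1+ suc n ] (ℤ-induction P base up down -[1+ n ])

shift-invariant⇒constant : (f : ℤ → ℤ) → (∀ i → f (i + 1ℤ) ≡ f i) → ∀ i → f i ≡ f 0ℤ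
shift-invariant⇒constant f inv =
  ℤ-induction (λ i → f i ≡ f 0ℤ) refl
    (λ i fi → trans (inv i) fi) (λ i fi+1 → trans (sym (inv i)) fi+1)

<⇒+suc : ∀ {p q} → p < q → ∃ λ n → q ≡ p + + suc n
<⇒+suc {p} {q} p<q with q - sucℤ p in eq | i≤j⇒0≤j-i (i<j⇒suc[i]≤j p<q)
... | + n      | _  = n , trans (split p q) (cong (λ m → p + (1ℤ + m)) eq)
  where
  split : ∀ p q → q ≡ p + (1ℤ + (q - (1ℤ + p)))
  split = solve 2 (λ p q → q := p :+ (con 1ℤ :+ (q :- (con 1ℤ :+ p)))) refl
... | -[1+ _ ] | ()

det : (ℤ → ℤ) → (ℤ → ℤ) → ℤ → ℤ → ℤ
det u v p q = u p * v q - u q * v p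

det-transpose : (f : ℤ → ℤ → ℤ) (i j p q : ℤ) →
  det (f i) (f j) p q ≡ det (λ k → f k p) (λ k → f k q) i j
det-transpose f i j p q = cong (f i p * f j q -_) (*-comm (f i q) (f j p))

plücker-rows : ∀ a₀ a₁ b₀ b₁ g₀ g₁ →
  ((a₀ * g₁ - a₁ * g₀) * b₀ ≡ (b₀ * g₁ - b₁ * g₀) * a₀ + (a₀ * b₁ - a₁ * b₀) * g₀)
  × ((a₀ * g₁ - a₁ * g₀) * b₁ ≡ (b₀ * g₁ - b₁ * g₀) * a₁ + (a₀ * b₁ - a₁ * b₀) * g₁)
plücker-rows a₀ a₁ b₀ b₁ g₀ g₁ =
    solve 6 (λ a₀ a₁ b₀ b₁ g₀ g₁ →
      (a₀ :* g₁ :- a₁ :* g₀) :* b₀ := (b₀ :* g₁ :- b₁ :* g₀) :* a₀ :+ (a₀ :* b₁ :- a₁ :* b₀) :* g₀)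
      refl a₀ a₁ b₀ b₁ g₀ g₁
  , solve 6 (λ a₀ a₁ b₀ b₁ g₀ g₁ →
      (a₀ :* g₁ :- a₁ :* g₀) :* b₁ := (b₀ :* g₁ :- b₁ :* g₀) :* a₁ :+ (a₀ :* b₁ :- a₁ :* b₀) :* g₁)
      refl a₀ a₁ b₀ b₁ g₀ g₁

plücker-columns : (u v : ℤ → ℤ) (p j k : ℤ) →
  v j * det u v p k ≡ det u v p j * v k + det u v j k * v p
plücker-columns u v p j k =
  solve 6 (λ x₁ x₂ x₃ y₁ y₂ y₃ →
    y₂ :* (x₁ :* y₃ :- x₃ :* y₁) := (x₁ :* y₂ :- x₂ :* y₁) :* y₃ :+ (x₂ :* y₃ :- x₃ :* y₂) :* y₁)
    refl (u p) (u j) (u k) (v p) (v j) (v k)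

record ThreeTerm (u v w : ℤ → ℤ) : Set where
  constructor three-term
  field
    coefficient : ℤ
    recurrence  : ∀ p → u p + w p ≡ coefficient * v p

three-term-sym : ∀ {u v w} → ThreeTerm u v w → ThreeTerm w v u
three-term-sym {u} {v} {w} (three-term e rec) =
  three-term e λ p → trans (+-comm (w p) (u p)) (rec p)

-- Three consecutive rows of an array with positive middle row and all
-- adjacent minors equal to 1 satisfy a three-term recurrence: the
-- coefficient at column p is det a g p (p + 1), which is shift invariant
-- because a positive entry of b can be cancelled.
adjacent-minors⇒three-term : (a b g : ℤ → ℤ) → (∀ p → b p > 0ℤ) →
  (∀ p → det a b p (p + 1ℤ) ≡ 1ℤ) → (∀ p → det b g p (p + 1ℤ) ≡ 1ℤ) →
  ThreeTerm a b g
adjacent-minors⇒three-term a b g b>0 ab=1 bg=1 =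
  three-term (e 0ℤ) λ p → trans (sym (proj₁ (relation p))) (cong (_* b p) (constant p))
  where
  e : ℤ → ℤ
  e p = det a g p (p + 1ℤ)

  one* : ∀ {x} y → x ≡ 1ℤ → x * y ≡ y
  one* y x=1 = trans (cong (_* y) x=1) (*-identityˡ y)

  relation : ∀ p → (e p * b p ≡ a p + g p)
                 × (e p * b (p + 1ℤ) ≡ a (p + 1ℤ) + g (p + 1ℤ))
  relation p with plücker-rows (a p) (a (p + 1ℤ)) (b p) (b (p + 1ℤ)) (g p) (g (p + 1ℤ))
  ... | at-p , at-p+1 =
      trans at-p (cong₂ _+_ (one* (a p) (bg=1 p)) (one* (g p) (ab=1 p)))
    , trans at-p+1 (cong₂ _+_ (one* (a (p + 1ℤ)) (bg=1 p)) (one* (g (p + 1ℤ)) (ab=1 p)))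

  constant : ∀ p → e p ≡ e 0ℤ
  constant = shift-invariant⇒constant e λ p →
    *-cancelʳ-pos-≡ (b>0 (p + 1ℤ))
      (trans (proj₁ (relation (p + 1ℤ))) (sym (proj₂ (relation p))))

InSpan : (x y f : ℤ → ℤ) → Set
InSpan x y f = ∃₂ λ α β → ∀ p → f p ≡ α * x p + β * y p

span-left : ∀ x y → InSpan x y x
span-left x y = 1ℤ , 0ℤ , λ p →
  solve 2 (λ x y → x := con 1ℤ :* x :+ con 0ℤ :* y) refl (x p) (y p)

span-right : ∀ x y → InSpan x y y
span-right x y = 0ℤ , 1ℤ , λ p →
  solve 2 (λ x y → y := con 0ℤ :* x :+ con 1ℤ :* y) refl (x p) (y p)

span-three-term : ∀ {x y u v w} → InSpan x y u → InSpan x y v → ThreeTerm u v w →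
  InSpan x y w
span-three-term {x} {y} {u} {v} {w} (α , β , u=) (α′ , β′ , v=) (three-term e rec) =
  e * α′ - α , e * β′ - β , λ p → begin
    w p                                       ≡⟨ isolate (u p) (w p) ⟩
    (u p + w p) - u p                         ≡⟨ cong₂ _-_ (rec p) (u= p) ⟩
    e * v p - (α * x p + β * y p)             ≡⟨ cong (λ z → e * z - (α * x p + β * y p)) (v= p) ⟩
    e * (α′ * x p + β′ * y p) - (α * x p + β * y p)
                                              ≡⟨ collect e α β α′ β′ (x p) (y p) ⟩
    (e * α′ - α) * x p + (e * β′ - β) * y p   ∎
  where
  isolate : ∀ a b → b ≡ (a + b) - a
  isolate = solve 2 (λ a b → b := (a :+ b) :- a) refl

  collect : ∀ e α β α′ β′ X Y →
    e * (α′ * X + β′ * Y) - (α * X + β * Y) ≡ (e * α′ - α) * X + (e * β′ - β) * Y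
  collect = solve 7 (λ e α β α′ β′ X Y →
    e :* (α′ :* X :+ β′ :* Y) :- (α :* X :+ β :* Y) := (e :* α′ :- α) :* X :+ (e :* β′ :- β) :* Y)
    refl

det-span : ∀ {x y f g} → InSpan x y f → InSpan x y g →
  ∃ λ κ → ∀ p q → det f g p q ≡ κ * det x y p q
det-span {x} {y} {f} {g} (α , β , f=) (α′ , β′ , g=) =
  α * β′ - β * α′ , λ p q → begin
    f p * g q - f q * g p
      ≡⟨ cong₂ _-_ (cong₂ _*_ (f= p) (g= q)) (cong₂ _*_ (f= q) (g= p)) ⟩
    (α * x p + β * y p) * (α′ * x q + β′ * y q) - (α * x q + β * y q) * (α′ * x p + β′ * y p)
      ≡⟨ cauchy-binet α β α′ β′ (x p) (x q) (y p) (y q) ⟩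
    (α * β′ - β * α′) * det x y p q ∎
  where
  cauchy-binet : ∀ α β α′ β′ x₀ x₁ y₀ y₁ →
    (α * x₀ + β * y₀) * (α′ * x₁ + β′ * y₁) - (α * x₁ + β * y₁) * (α′ * x₀ + β′ * y₀)
      ≡ (α * β′ - β * α′) * (x₀ * y₁ - x₁ * y₀)
  cauchy-binet = solve 8 (λ α β α′ β′ x₀ x₁ y₀ y₁ →
    (α :* x₀ :+ β :* y₀) :* (α′ :* x₁ :+ β′ :* y₁) :- (α :* x₁ :+ β :* y₁) :* (α′ :* x₀ :+ β′ :* y₀)
      := (α :* β′ :- β :* α′) :* (x₀ :* y₁ :- x₁ :* y₀)) refl

span-factorization : ∀ {x y f g r s} → InSpan x y f → InSpan x y g → det x y r s ≡ 1ℤ →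
  ∀ p q → det f g p q ≡ det f g r s * det x y p q
span-factorization {x} {y} {f} {g} {r} {s} f∈ g∈ unit p q with det-span f∈ g∈
... | κ , factor = begin
  det f g p q               ≡⟨ factor p q ⟩
  κ * det x y p q           ≡⟨ cong (_* det x y p q) κ=minor ⟩
  det f g r s * det x y p q ∎
  where
  κ=minor : κ ≡ det f g r s
  κ=minor = sym (trans (factor r s) (trans (cong (κ *_) unit) (*-identityʳ κ)))

-- Two rows with positive second row and all adjacent minors equal to 1
-- have all minors det u v p q with p < q positive; the induction on q - p
-- passes from q to q + 1 through the Plücker relation for p, q, q + 1.
det-pos : (u v : ℤ → ℤ) → (∀ p → v p > 0ℤ) → (∀ p → det u v p (p + 1ℤ) ≡ 1ℤ) →
  ∀ {p q} → p < q → det u v p q > 0ℤ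
det-pos u v v>0 adjacent {p} p<q with <⇒+suc p<q
... | n , refl = at-distance n
  where
  one>0 : 1ℤ > 0ℤ
  one>0 = +<+ (ℕ.s≤s ℕ.z≤n)

  next : ∀ n → (p + + suc n) + 1ℤ ≡ p + + suc (suc n)
  next n = trans (+-assoc p (+ suc n) 1ℤ) (cong (λ m → p + + suc m) (ℕP.+-comm n 1))

  at-distance : ∀ n → det u v p (p + + suc n) > 0ℤ
  at-distance zero = subst (_> 0ℤ) (sym (adjacent p)) one>0
  at-distance (suc n) = subst (λ k → det u v p k > 0ℤ) (next n)
    (*-cancelˡ-pos (v>0 j)
      (subst (_> 0ℤ) (sym (plücker-columns u v p j (j + 1ℤ)))
        (+-pos (*-pos (at-distance n) (v>0 (j + 1ℤ)))
               (*-pos (subst (_> 0ℤ) (sym (adjacent j)) one>0) (v>0 p)))))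
    where j = p + + suc n

-- In an SL₂-tiling every row is an integer combination of rows 0 and 1:
-- consecutive triples of rows satisfy three-term recurrences, which can be
-- run upwards and downwards from rows 0 and 1.
rows-in-span : (T : SL₂Tiling) → ∀ i → InSpan (t T 0ℤ) (t T 1ℤ) (t T i)
rows-in-span T i = proj₁ (ℤ-induction Consecutive base up down i)
  where
  x y : ℤ → ℤ
  x = t T 0ℤ
  y = t T 1ℤ

  Consecutive : ℤ → Set
  Consecutive i = InSpan x y (t T i) × InSpan x y (t T (i + 1ℤ))

  recurrence : ∀ i → ThreeTerm (t T i) (t T (i + 1ℤ)) (t T ((i + 1ℤ) + 1ℤ))
  recurrence i = adjacent-minors⇒three-term (t T i) (t T (i + 1ℤ)) (t T ((i + 1ℤ) + 1ℤ))
    (positive T (i + 1ℤ)) (unimod T i) (unimod T (i + 1ℤ))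

  recurrence-down : ∀ i → ThreeTerm (t T ((i + 1ℤ) + 1ℤ)) (t T (i + 1ℤ)) (t T i)
  recurrence-down i = three-term-sym (recurrence i)

  base : Consecutive 0ℤ
  base = span-left x y , span-right x y

  up : ∀ i → Consecutive i → Consecutive (i + 1ℤ)
  up i (row-i , row-i+1) = row-i+1 , span-three-term row-i row-i+1 (recurrence i)

  down : ∀ i → Consecutive (i + 1ℤ) → Consecutive i
  down i (row-i+1 , row-i+2) =
    span-three-term row-i+2 row-i+1 (recurrence-down i) , row-i+1

-- Every 2×2 minor of a tiling factors as c i j · d p q, because all rows
-- lie in the span of rows 0 and 1, and d 0 1 = 1.
minor-factorization : (T : SL₂Tiling) (i j p q : ℤ) →
  det (t T i) (t T j) p q ≡ c T i j * d T p q
minor-factorization T i j p q =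
  span-factorization (rows-in-span T i) (rows-in-span T j) (unimod T 0ℤ 0ℤ) p q

-- c i j is a minor of the columns 0 and 1, read in the transposed array.
c-pos : (T : SL₂Tiling) → ∀ {i j} → i < j → c T i j > 0ℤ
c-pos T {i} {j} i<j = subst (_> 0ℤ) (sym (det-transpose (t T) i j 0ℤ 1ℤ))
  (det-pos (λ k → t T k 0ℤ) (λ k → t T k 1ℤ) (λ k → positive T k 1ℤ)
    (λ k → trans (sym (det-transpose (t T) k (k + 1ℤ) 0ℤ 1ℤ)) (unimod T k 0ℤ)) i<j)

d-pos : (T : SL₂Tiling) → ∀ {p q} → p < q → d T p q > 0ℤ
d-pos T = det-pos (t T 0ℤ) (t T 1ℤ) (positive T 1ℤ) (unimod T 0ℤ)

proposition5p7 : (T : SL₂Tiling) (i j p q : ℤ) → i < j → p < q →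
    (t T i p * t T j q - t T i q * t T j p ≡ c T i j * d T p q)
    × (t T i p * t T j q - t T i q * t T j p > 0ℤ)
proposition5p7 T i j p q i<j p<q =
  factorization , subst (_> 0ℤ) (sym factorization) (*-pos (c-pos T i<j) (d-pos T p<q))
  where
  factorization : t T i p * t T j q - t T i q * t T j p ≡ c T i j * d T p q
  factorization = minor-factorization T i j p q
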